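{- For every prime $p\geq 3$ and every integer $k\in[3,p]$, there exist at least $p$ mutually orthogonal cyclic $k$-cycle decompositions of $K_{(2k+1)\times p}$.
   Context: $K_{m\times n}$ denotes the complete multipartite graph with $m$ parts of size $n$. A $k$-cycle decomposition of a graph is a set of $k$-cycles whose edge sets partition the edge set of the graph. A $k$-cycle decomposition $\mathcal{D}$ of $K_{m\times n}$ is cyclic if the vertex set of $K_{m\times n}$ is $\mathbb{Z}_{mn}$, with the parts being the cosets of the subgroup of order $n$, and $C+g\in\mathcal{D}$ for every $C\in\mathcal{D}$ and $g\in\mathbb{Z}_{mn}$. Two cycle decompositions of the same graph are orthogonal if no cycle of one shares more than one edge with a cycle of the other. -}

module Defs where

open import Data.Nat using (ℕ; zero; suc; _+_; _*_)
open import Data.Nat.DivMod using (_%_; m%n<n)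
open import Data.Fin using (Fin; toℕ; fromℕ<)
open import Data.Product using (Σ; ∃; _×_; _,_)
open import Data.Sum using (_⊎_)
open import Data.List using (List; length; lookup)
open import Data.List.Membership.Propositional using (_∈_)
open import Data.List.Relation.Unary.All using (All)
open import Data.List.Relation.Unary.Any using (Any)
open import Relation.Binary.PropositionalEquality using (_≡_; _≢_)
open import Function.Definitions using (Injective)

-- x mod m (the case m = 0 never matters: then the graph has no vertices)
modN : ℕ → ℕ → ℕ
modN zero    x = x
modN (suc m) x = x % suc m

addMod : {N : ℕ} → Fin N → Fin N → Fin N
addMod {suc N} x y = fromℕ< (m%n<n (toℕ x + toℕ y) (suc N))

nextIx : {k : ℕ} → Fin k → Fin k
nextIx {suc k} i = fromℕ< (m%n<n (toℕ i + 1) (suc k))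

-- K_{m×n} on vertex set ℤ_{mn}: the parts are the cosets of the subgroup
-- of order n, i.e. of ⟨m⟩ = {0, m, 2m, …}; so x, y lie in the same part
-- iff x ≡ y (mod m).
Adjacent : (m n : ℕ) → Fin (m * n) → Fin (m * n) → Set
Adjacent m n x y = modN m (toℕ x) ≢ modN m (toℕ y)

-- A k-cycle is given by a cyclic sequence of k distinct vertices
-- c 0, c 1, …, c (k-1); its edges are {c i, c (i+1 mod k)}.
Cyc : ℕ → ℕ → Set
Cyc k N = Fin k → Fin N

EdgeOf : {k N : ℕ} → Cyc k N → Fin N → Fin N → Set
EdgeOf c x y = ∃ λ i → (c i ≡ x × c (nextIx i) ≡ y) ⊎ (c i ≡ y × c (nextIx i) ≡ x)

IsKCycleIn : (m n k : ℕ) → Cyc k (m * n) → Set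
IsKCycleIn m n k c = Injective _≡_ _≡_ c × (∀ i → Adjacent m n (c i) (c (nextIx i)))

ExactlyOne : {A : Set} → (A → Set) → List A → Set
ExactlyOne P xs = Σ (Fin (length xs)) λ i → P (lookup xs i) × (∀ j → P (lookup xs j) → j ≡ i)

IsKCycleDecomp : (m n k : ℕ) → List (Cyc k (m * n)) → Set
IsKCycleDecomp m n k D =
  All (IsKCycleIn m n k) D ×
  (∀ x y → Adjacent m n x y → ExactlyOne (λ c → EdgeOf c x y) D)

shift : {k N : ℕ} → Fin N → Cyc k N → Cyc k N
shift g c i = addMod (c i) g

SameCycle : {k N : ℕ} → Cyc k N → Cyc k N → Set
SameCycle c d = ∀ x y → (EdgeOf c x y → EdgeOf d x y) × (EdgeOf d x y → EdgeOf c x y)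

IsCyclic : {k N : ℕ} → List (Cyc k N) → Set
IsCyclic {k} {N} D = ∀ c → c ∈ D → ∀ (g : Fin N) → Any (SameCycle (shift g c)) D

IsCyclicKCycleDecomp : (m n k : ℕ) → List (Cyc k (m * n)) → Set
IsCyclicKCycleDecomp m n k D = IsKCycleDecomp m n k D × IsCyclic D

Orthogonal : {k N : ℕ} → List (Cyc k N) → List (Cyc k N) → Set
Orthogonal D₁ D₂ = ∀ c₁ c₂ → c₁ ∈ D₁ → c₂ ∈ D₂ → ∀ x y u v →
  EdgeOf c₁ x y → EdgeOf c₂ x y → EdgeOf c₁ u v → EdgeOf c₂ u v →
  (x ≡ u × y ≡ v) ⊎ (x ≡ v × y ≡ u)

-- Let m = 2k + 1. A zigzag k-cycle (v₀, …, v_{k-1}) in ℤ_m has edge differences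
-- ±(v_{j+1} − v_j) running exactly once through the nonzero residues, so its
-- translates decompose K_m. For i, t ∈ ℤ_p, lift it to the k-cycle C_{i,t} in ℤ_{mp}
-- with vertices v_j + m (A_j t + B_j i); its j-th edge difference is
-- Δv_j + m (ΔA_j t + ΔB_j i). Modulo m, the difference y − x of an edge {x, y} of
-- K_{m×p} fixes the position j and the orientation of {x, y} in every translate
-- C_{i,t} + g containing it, and modulo p it then fixes ΔA_j t + ΔB_j i. Since ΔA_j is
-- a unit, for each i every edge lies in exactly one such translate, so
-- F_i = {C_{i,t} + g} is a cyclic decomposition. If C_{i,t} + g and C_{i′,t′} + g′
-- shared edges at two positions j ≠ l, eliminating t − t′ would give
-- (ΔA_j ΔB_l − ΔA_l ΔB_j)(i − i′) ≡ 0 (mod p), hence i = i′. With A_j = 2j − k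
-- (A₀ = 0) and B_j = j(j − 1) one has ΔB_j = j ΔA_j and ΔA_j ∈ {2, 2 − k}, so that
-- determinant is ΔA_j ΔA_l (l − j), a unit modulo p when k ≤ p.
module Submission where

open import Defs
open import Data.Nat as ℕ using (ℕ; zero; suc; NonZero; _<_; _≤_; z≤n; s≤s; _∸_; ⌊_/2⌋)
import Data.Nat.Properties as ℕ
import Data.Nat.Divisibility as ℕ
import Data.Nat.DivMod as ℕ
import Data.Nat.Tactic.RingSolver as ℕ-solver
open import Data.Nat.Primality using (Prime; euclidsLemma; prime⇒nonZero)
open import Data.Integer as ℤ using (ℤ; +_; ∣_∣)
import Data.Integer.Properties as ℤ
open import Data.Integer.DivMod using (_%ℕ_; _/ℕ_; n%ℕd<d; a≡a%ℕn+[a/ℕn]*n)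
open import Data.Integer.Divisibility.Signed
open import Data.Integer.Tactic.RingSolver using (solve-∀)
open import Data.Fin as Fin using (Fin; toℕ; fromℕ<)
import Data.Fin.Properties as Fin
open import Data.List using (List; tabulate; lookup)
import Data.List.Properties as List
import Data.List.Relation.Unary.All.Properties as All
open import Data.List.Relation.Unary.Any using (Any)
import Data.List.Relation.Unary.Any.Properties as Any
open import Data.List.Membership.Propositional using (_∈_)
open import Data.List.Membership.Propositional.Properties using (∈-tabulate⁻)
open import Data.Product using (∃; ∃₂; _×_; _,_; proj₁; proj₂; uncurry; map₂)
open import Data.Sum as Sum using (_⊎_; inj₁; inj₂; [_,_]′)
open import Relation.Nullary using (¬_; Dec; yes; no; contradiction)
open import Relation.Binary.PropositionalEquality
open import Relation.Binary.Bundles using (Setoid)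
open import Relation.Binary.Definitions using (tri<; tri≈; tri>)
import Relation.Binary.Reasoning.Setoid as SetoidReasoning
open import Function using (_∘_; _∘′_)
open import Function.Definitions using (Injective)

module Congruence where

  open import Data.Integer using (_+_; _*_; -_; _-_)

  infix 4 _≡_mod_
  record _≡_mod_ (a b : ℤ) (n : ℕ) : Set where
    constructor congruent
    field divides-difference : + n ∣ a - b
  open _≡_mod_ public

  module _ {n : ℕ} where

    mod-reflexive : ∀ {a b} → a ≡ b → a ≡ b mod n
    mod-reflexive {a} refl = congruent (divides (+ 0) (ℤ.+-inverseʳ a))

    mod-refl : ∀ {a} → a ≡ a mod n
    mod-refl = mod-reflexive refl

    mod-sym : ∀ {a b} → a ≡ b mod n → b ≡ a mod n
    mod-sym {a} {b} (congruent h) = congruent (subst (+ n ∣_) (negate a b) (∣m⇒∣-m h))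
      where
      negate : ∀ a b → - (a - b) ≡ b - a
      negate = solve-∀

    mod-trans : ∀ {a b c} → a ≡ b mod n → b ≡ c mod n → a ≡ c mod n
    mod-trans {a} {b} {c} (congruent h) (congruent h′) =
      congruent (subst (+ n ∣_) (ℤ.+-minus-telescope a b c) (∣m∣n⇒∣m+n h h′))

    mod-setoid : Setoid _ _
    mod-setoid = record
      { Carrier       = ℤ
      ; _≈_           = λ a b → a ≡ b mod n
      ; isEquivalence = record { refl = mod-refl ; sym = mod-sym ; trans = mod-trans }
      }

    +-cong-mod : ∀ {a b c d} → a ≡ b mod n → c ≡ d mod n → a + c ≡ b + d mod n
    +-cong-mod {a} {b} {c} {d} (congruent h) (congruent h′) =
      congruent (subst (+ n ∣_) (interchange a b c d) (∣m∣n⇒∣m+n h h′))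
      where
      interchange : ∀ a b c d → (a - b) + (c - d) ≡ (a + c) - (b + d)
      interchange = solve-∀

    neg-cong-mod : ∀ {a b} → a ≡ b mod n → - a ≡ - b mod n
    neg-cong-mod {a} {b} (congruent h) = congruent (subst (+ n ∣_) (negate a b) (∣m⇒∣-m h))
      where
      negate : ∀ a b → - (a - b) ≡ - a - - b
      negate = solve-∀

    minus-cong-mod : ∀ {a b c d} → a ≡ b mod n → c ≡ d mod n → a - c ≡ b - d mod n
    minus-cong-mod h h′ = +-cong-mod h (neg-cong-mod h′)

    +-cancelˡ-mod : ∀ c {a b} → c + a ≡ c + b mod n → a ≡ b mod n
    +-cancelˡ-mod c {a} {b} (congruent h) = congruent (subst (+ n ∣_) (cancel c a b) h)
      where
      cancel : ∀ c a b → (c + a) - (c + b) ≡ a - b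
      cancel = solve-∀

    +-multiple-mod : ∀ a q → a + + n * q ≡ a mod n
    +-multiple-mod a q = congruent (divides q (cancel a q (+ n)))
      where
      cancel : ∀ a q n → a + n * q - a ≡ q * n
      cancel = solve-∀

  module ModReasoning (n : ℕ) = SetoidReasoning (mod-setoid {n})

  mod-weakenˡ : ∀ m p {a b} → a ≡ b mod (m ℕ.* p) → a ≡ b mod m
  mod-weakenˡ m p (congruent h) =
    congruent (∣-trans (divides (+ p) (trans (ℤ.pos-* m p) (ℤ.*-comm (+ m) (+ p)))) h)

  private
    *-distribˡ-minus : ∀ c a b → c * (a - b) ≡ c * a - c * b
    *-distribˡ-minus = solve-∀

  *-monoˡ-mod : ∀ m p {a b} → a ≡ b mod p → + m * a ≡ + m * b mod (m ℕ.* p)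
  *-monoˡ-mod m p {a} {b} (congruent h) = congruent
    (subst₂ _∣_ (sym (ℤ.pos-* m p)) (*-distribˡ-minus (+ m) a b) (*-monoʳ-∣ (+ m) h))

  *-cancelˡ-mod : ∀ m p .{{_ : NonZero m}} {a b} → + m * a ≡ + m * b mod (m ℕ.* p) → a ≡ b mod p
  *-cancelˡ-mod m p {a} {b} (congruent h) = congruent
    (*-cancelˡ-∣ (+ m) (subst₂ _∣_ (ℤ.pos-* m p) (sym (*-distribˡ-minus (+ m) a b)) h))

  mod-unique : ∀ {n r r′} → r < n → r′ < n → + r ≡ + r′ mod n → r ≡ r′
  mod-unique {n} {r} {r′} r<n r′<n (congruent h) =
    ℤ.+-injective (ℤ.i-j≡0⇒i≡j (+ r) (+ r′) (ℤ.∣i∣≡0⇒i≡0 (distance≡0 (∣⇒∣ᵤ h))))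
    where
    distance<n : ∣ + r - + r′ ∣ < n
    distance<n = subst (_< n) (cong ∣_∣ (sym (ℤ.[+m]-[+n]≡m⊖n r r′)))
      (ℕ.≤-<-trans (ℤ.∣m⊝n∣≤m⊔n r r′) (ℕ.⊔-pres-<m r<n r′<n))
    distance≡0 : n ℕ.∣ ∣ + r - + r′ ∣ → ∣ + r - + r′ ∣ ≡ 0
    distance≡0 n∣d with ∣ + r - + r′ ∣ in eq
    ... | zero  = refl
    ... | suc d = contradiction n∣d (ℕ.>⇒∤ (subst (_< n) eq distance<n))

  prime-∣-* : ∀ {p} → Prime p → ∀ {a b} → + p ∣ a * b → (+ p ∣ a) ⊎ (+ p ∣ b)
  prime-∣-* {p} p-prime {a} {b} h =
    Sum.map ∣ᵤ⇒∣ ∣ᵤ⇒∣ (euclidsLemma ∣ a ∣ ∣ b ∣ p-prime (subst (p ℕ.∣_) (ℤ.abs-* a b) (∣⇒∣ᵤ h)))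

  small-∤ : ∀ {p n} → 0 < n → n < p → ¬ (+ p ∣ + n)
  small-∤ {n = suc n} _ n<p p∣n = ℕ.>⇒∤ n<p (∣⇒∣ᵤ p∣n)

  toℤ : ∀ {n} → Fin n → ℤ
  toℤ x = + toℕ x

  opaque
    fromℤ : ∀ n .{{_ : NonZero n}} → ℤ → Fin n
    fromℤ n a = fromℕ< (n%ℕd<d a n)

    toℕ-fromℤ : ∀ n .{{_ : NonZero n}} a → toℕ (fromℤ n a) ≡ a %ℕ n
    toℕ-fromℤ n a = Fin.toℕ-fromℕ< (n%ℕd<d a n)

  module _ {n : ℕ} .{{_ : NonZero n}} where

    toℤ-fromℤ : ∀ a → toℤ (fromℤ n a) ≡ a mod n
    toℤ-fromℤ a = begin
      toℤ (fromℤ n a)                ≡⟨ cong +_ (toℕ-fromℤ n a) ⟩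
      + (a %ℕ n)                     ≈⟨ +-multiple-mod (+ (a %ℕ n)) (a /ℕ n) ⟨
      + (a %ℕ n) + + n * (a /ℕ n)    ≡⟨ cong (_+_ (+ (a %ℕ n))) (ℤ.*-comm (+ n) (a /ℕ n)) ⟩
      + (a %ℕ n) + (a /ℕ n) * + n    ≡⟨ a≡a%ℕn+[a/ℕn]*n a n ⟨
      a                              ∎
      where open ModReasoning n

    toℤ-injective-mod : ∀ {x y : Fin n} → toℤ x ≡ toℤ y mod n → x ≡ y
    toℤ-injective-mod {x} {y} h = Fin.toℕ-injective (mod-unique (Fin.toℕ<n x) (Fin.toℕ<n y) h)

    ∣-difference⇒≡ : ∀ {x y : Fin n} → + n ∣ toℤ x - toℤ y → x ≡ y
    ∣-difference⇒≡ h = toℤ-injective-mod (congruent h)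

    mod⇒fromℤ≡ : ∀ {a} {x : Fin n} → a ≡ toℤ x mod n → fromℤ n a ≡ x
    mod⇒fromℤ≡ {a} h = toℤ-injective-mod (mod-trans (toℤ-fromℤ a) h)

    fromℤ-cong : ∀ {a b} → a ≡ b mod n → fromℤ n a ≡ fromℤ n b
    fromℤ-cong {a} {b} h = mod⇒fromℤ≡ (mod-trans h (mod-sym (toℤ-fromℤ b)))

    fromℤ-injective : ∀ {a b} → fromℤ n a ≡ fromℤ n b → a ≡ b mod n
    fromℤ-injective {a} {b} eq =
      mod-trans (mod-sym (toℤ-fromℤ a)) (mod-trans (mod-reflexive (cong toℤ eq)) (toℤ-fromℤ b))

  injective⇒surjective : ∀ {n} (f : Fin n → Fin n) → Injective _≡_ _≡_ f → ∀ y → ∃ λ x → f x ≡ y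
  injective⇒surjective {suc n} f f-injective y with Fin.any? (λ x → f x Fin.≟ y)
  ... | yes hit = hit
  ... | no miss = contradiction (Fin.injective⇒≤ punched-injective) ℕ.1+n≰n
    where
    y≢f : ∀ x → y ≢ f x
    y≢f x y≡fx = miss (x , sym y≡fx)
    punched : Fin (suc n) → Fin n
    punched x = Fin.punchOut (y≢f x)
    punched-injective : Injective _≡_ _≡_ punched
    punched-injective {x} {x′} eq = f-injective (Fin.punchOut-injective (y≢f x) (y≢f x′) eq)

  linear-congruence-solvable : ∀ {p} → Prime p → ∀ {a} → ¬ (+ p ∣ a) → ∀ q →
                               ∃ λ (t : Fin p) → a * toℤ t ≡ q mod p
  linear-congruence-solvable {p} p-prime {a} p∤a q =
    map₂ (fromℤ-injective {b = q}) (injective⇒surjective multiply multiply-injective (fromℤ p q))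
    where
    instance _ = prime⇒nonZero p-prime
    multiply : Fin p → Fin p
    multiply t = fromℤ p (a * toℤ t)
    multiply-injective : Injective _≡_ _≡_ multiply
    multiply-injective {t} {t′} eq =
      [ (λ p∣a → contradiction p∣a p∤a) , ∣-difference⇒≡ ]′
      (prime-∣-* p-prime (subst (+ p ∣_) (sym (*-distribˡ-minus a (toℤ t) (toℤ t′)))
        (divides-difference (fromℤ-injective {a = a * toℤ t} {b = a * toℤ t′} eq))))

module CycleEdges where

  open import Data.Integer using (_+_; _*_; -_; _-_)
  open Congruence

  modN≡toℕ-fromℤ : ∀ m .{{_ : NonZero m}} a → modN m a ≡ toℕ (fromℤ m (+ a))
  modN≡toℕ-fromℤ (suc m) a = sym (toℕ-fromℤ (suc m) (+ a))

  module _ (m n : ℕ) .{{_ : NonZero m}} {x y : Fin (m ℕ.* n)} where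

    adjacent⇒incongruent : Adjacent m n x y → ¬ (toℤ x ≡ toℤ y mod m)
    adjacent⇒incongruent adjacent x≡y = adjacent (begin
      modN m (toℕ x)           ≡⟨ modN≡toℕ-fromℤ m (toℕ x) ⟩
      toℕ (fromℤ m (toℤ x))    ≡⟨ cong toℕ (fromℤ-cong x≡y) ⟩
      toℕ (fromℤ m (toℤ y))    ≡⟨ modN≡toℕ-fromℤ m (toℕ y) ⟨
      modN m (toℕ y)           ∎)
      where open ≡-Reasoning

    incongruent⇒adjacent : ¬ (toℤ x ≡ toℤ y mod m) → Adjacent m n x y
    incongruent⇒adjacent x≢y eq = x≢y (fromℤ-injective (Fin.toℕ-injective (begin
      toℕ (fromℤ m (toℤ x))    ≡⟨ modN≡toℕ-fromℤ m (toℕ x) ⟨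
      modN m (toℕ x)           ≡⟨ eq ⟩
      modN m (toℕ y)           ≡⟨ modN≡toℕ-fromℤ m (toℕ y) ⟩
      toℕ (fromℤ m (toℤ y))    ∎)))
      where open ≡-Reasoning

  addMod≡fromℤ : ∀ {N} .{{_ : NonZero N}} (x y : Fin N) → addMod x y ≡ fromℤ N (toℤ x + toℤ y)
  addMod≡fromℤ {suc N} x y =
    Fin.toℕ-injective (trans (Fin.toℕ-fromℕ< _) (sym (toℕ-fromℤ (suc N) (toℤ x + toℤ y))))

  toℕ-nextIx≡ : ∀ {k} (j : Fin (suc k)) → toℕ (nextIx j) ≡ suc (toℕ j) ℕ.% suc k
  toℕ-nextIx≡ {k} j = trans (Fin.toℕ-fromℕ< _) (cong (ℕ._% suc k) (ℕ.+-comm (toℕ j) 1))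

  toℕ-nextIx : ∀ {k} (j : Fin k) →
    (suc (toℕ j) < k × toℕ (nextIx j) ≡ suc (toℕ j)) ⊎ (suc (toℕ j) ≡ k × toℕ (nextIx j) ≡ 0)
  toℕ-nextIx {suc k} j with suc (toℕ j) ℕ.<? suc k
  ... | yes inner = inj₁ (inner , trans (toℕ-nextIx≡ j) (ℕ.m<n⇒m%n≡m inner))
  ... | no  outer = inj₂ (last , trans (toℕ-nextIx≡ j) (trans (cong (ℕ._% suc k) last) (ℕ.n%n≡0 (suc k))))
    where
    last : suc (toℕ j) ≡ suc k
    last = ℕ.≤-antisym (Fin.toℕ<n j) (ℕ.≮⇒≥ outer)

  Δ : ∀ {k} → (Fin k → ℤ) → Fin k → ℤ
  Δ f j = f (nextIx j) - f j

  data Orientation : Set where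
    forward backward : Orientation

  forward≢backward : forward ≢ backward
  forward≢backward ()

  signed : Orientation → ℤ → ℤ
  signed forward  d = d
  signed backward d = - d

  infixl 7 _·_
  _·_ : Orientation → Orientation → Orientation
  forward  · o        = o
  backward · forward  = backward
  backward · backward = forward

  signed-involutive : ∀ o d → signed o (signed o d) ≡ d
  signed-involutive forward  d = refl
  signed-involutive backward d = ℤ.neg-involutive d

  signed-· : ∀ o o′ d → signed (o · o′) d ≡ signed o (signed o′ d)
  signed-· forward  o′       d = refl
  signed-· backward forward  d = refl
  signed-· backward backward d = sym (ℤ.neg-involutive d)

  ·-cancelʳ : ∀ {o o′} s → o · s ≡ o′ · s → o ≡ o′
  ·-cancelʳ {forward}  {forward}  s        eq = refl
  ·-cancelʳ {backward} {backward} s        eq = refl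
  ·-cancelʳ {forward}  {backward} forward  ()
  ·-cancelʳ {forward}  {backward} backward ()
  ·-cancelʳ {backward} {forward}  forward  ()
  ·-cancelʳ {backward} {forward}  backward ()

  signed-cong-mod : ∀ {n} o {a b} → a ≡ b mod n → signed o a ≡ signed o b mod n
  signed-cong-mod forward  h = h
  signed-cong-mod backward h = neg-cong-mod h

  signed-transpose-mod : ∀ {n} o {a b} → a ≡ signed o b mod n → signed o a ≡ b mod n
  signed-transpose-mod o {a} {b} h = mod-trans (signed-cong-mod o h) (mod-reflexive (signed-involutive o b))

  signed-injective-mod : ∀ {n} o {a b} → signed o a ≡ signed o b mod n → a ≡ b mod n
  signed-injective-mod o {a} {b} h =
    subst₂ (_≡_mod _) (signed-involutive o a) (signed-involutive o b) (signed-cong-mod o h)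

  source target : Orientation → {A : Set} → A → A → A
  source forward  x y = x
  source backward x y = y
  target forward  x y = y
  target backward x y = x

  source+signed : ∀ {N} o (x y : Fin N) →
    toℤ (source o x y) + signed o (toℤ y - toℤ x) ≡ toℤ (target o x y)
  source+signed forward  x y = cancel (toℤ x) (toℤ y)
    where
    cancel : ∀ a b → a + (b - a) ≡ b
    cancel = solve-∀
  source+signed backward x y = cancel (toℤ x) (toℤ y)
    where
    cancel : ∀ a b → b + - (b - a) ≡ a
    cancel = solve-∀

  record OrientedEdge {k N} (c : Cyc k N) (x y : Fin N) : Set where
    constructor oriented-edge
    field
      position    : Fin k
      orientation : Orientation
      at-source   : c position ≡ source orientation x y
      at-target   : c (nextIx position) ≡ target orientation x y
  open OrientedEdge public

  module _ {k N} {c : Cyc k N} {x y : Fin N} where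

    orient : EdgeOf c x y → OrientedEdge c x y
    orient (j , inj₁ (cj≡x , cj′≡y)) = oriented-edge j forward  cj≡x cj′≡y
    orient (j , inj₂ (cj≡y , cj′≡x)) = oriented-edge j backward cj≡y cj′≡x

    unorient : OrientedEdge c x y → EdgeOf c x y
    unorient (oriented-edge j forward  cj≡x cj′≡y) = j , inj₁ (cj≡x , cj′≡y)
    unorient (oriented-edge j backward cj≡y cj′≡x) = j , inj₂ (cj≡y , cj′≡x)

    oriented-difference : (E : OrientedEdge c x y) →
      toℤ y - toℤ x ≡ signed (orientation E) (Δ (toℤ ∘ c) (position E))
    oriented-difference (oriented-edge j forward  refl refl) = refl
    oriented-difference (oriented-edge j backward refl refl) = flip (toℤ (c j)) (toℤ (c (nextIx j)))
      where
      flip : ∀ a b → a - b ≡ - (b - a)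
      flip = solve-∀

  same-position⇒same-edge : ∀ {k N} {c : Cyc k N} {x y u w}
    (E : OrientedEdge c x y) (E′ : OrientedEdge c u w) →
    position E ≡ position E′ → (x ≡ u × y ≡ w) ⊎ (x ≡ w × y ≡ u)
  same-position⇒same-edge (oriented-edge j forward  refl refl) (oriented-edge j forward  refl refl) refl =
    inj₁ (refl , refl)
  same-position⇒same-edge (oriented-edge j forward  refl refl) (oriented-edge j backward refl refl) refl =
    inj₂ (refl , refl)
  same-position⇒same-edge (oriented-edge j backward refl refl) (oriented-edge j forward  refl refl) refl =
    inj₂ (refl , refl)
  same-position⇒same-edge (oriented-edge j backward refl refl) (oriented-edge j backward refl refl) refl =
    inj₁ (refl , refl)

  pointwise⇒sameCycle : ∀ {k N} {c d : Cyc k N} → (∀ j → c j ≡ d j) → SameCycle c d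
  pointwise⇒sameCycle {k} {N} c≗d x y = transport c≗d , transport (sym ∘ c≗d)
    where
    transport : ∀ {c d : Cyc k N} → (∀ j → c j ≡ d j) → EdgeOf c x y → EdgeOf d x y
    transport c≗d (j , inj₁ (cj≡x , cj′≡y)) =
      j , inj₁ (trans (sym (c≗d j)) cj≡x , trans (sym (c≗d (nextIx j))) cj′≡y)
    transport c≗d (j , inj₂ (cj≡y , cj′≡x)) =
      j , inj₂ (trans (sym (c≗d j)) cj≡y , trans (sym (c≗d (nextIx j))) cj′≡x)

  exactlyOne-tabulate : ∀ {A : Set} {n} (f : Fin n → A) {P : A → Set} (a : Fin n) →
    P (f a) → (∀ b → P (f b) → b ≡ a) → ExactlyOne P (tabulate f)
  exactlyOne-tabulate f {P} a Pfa unique =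
    Fin.cast (sym length≡) a , subst P (sym (List.lookup-tabulate f a)) Pfa , λ j Pj → begin
      j                                            ≡⟨ Fin.cast-involutive (sym length≡) length≡ j ⟨
      Fin.cast (sym length≡) (Fin.cast length≡ j)  ≡⟨ cong (Fin.cast (sym length≡))
                                                           (unique _ (subst P (lookup≡ j) Pj)) ⟩
      Fin.cast (sym length≡) a                     ∎
    where
    open ≡-Reasoning
    length≡ = List.length-tabulate f
    lookup≡ : ∀ j → lookup (tabulate f) j ≡ f (Fin.cast length≡ j)
    lookup≡ j = trans (cong (lookup (tabulate f)) (sym (Fin.cast-involutive (sym length≡) length≡ j)))
                      (List.lookup-tabulate f (Fin.cast length≡ j))

module Lifting where

  open import Data.Integer using (_+_; _*_; -_; _-_)
  open Congruence
  open CycleEdges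

  record IsBaseCycle (m k : ℕ) (v : Fin k → ℤ) : Set where
    field
      vertices-distinct    : ∀ {j j′} → v j ≡ v j′ mod m → j ≡ j′
      differences-distinct : ∀ {j j′ o o′} → signed o (Δ v j) ≡ signed o′ (Δ v j′) mod m →
                             j ≡ j′ × o ≡ o′
      differences-cover    : ∀ r → ¬ (+ m ∣ r) → ∃₂ λ j o → r ≡ signed o (Δ v j) mod m

  record IsOrthogonalLifting (p k : ℕ) (A B : Fin k → ℤ) : Set where
    field
      slope-nonzero      : ∀ j → ¬ (+ p ∣ Δ A j)
      slopes-independent : ∀ {j l} → j ≢ l → ¬ (+ p ∣ Δ A j * Δ B l - Δ A l * Δ B j)

  module LiftedDecompositions
    (m p k : ℕ) .{{_ : NonZero m}} (p-prime : Prime p) {v A B : Fin k → ℤ}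
    (base-cycle : IsBaseCycle m k v) (lifting : IsOrthogonalLifting p k A B) where

    open IsBaseCycle base-cycle
    open IsOrthogonalLifting lifting

    N : ℕ
    N = m ℕ.* p

    instance
      p≢0 : NonZero p
      p≢0 = prime⇒nonZero p-prime
      N≢0 : NonZero N
      N≢0 = ℕ.m*n≢0 m p

    level : Fin p → Fin p → Fin k → ℤ
    level i t j = A j * toℤ t + B j * toℤ i

    slope : Fin p → Fin p → Fin k → ℤ
    slope i t j = Δ A j * toℤ t + Δ B j * toℤ i

    base : Fin p → Fin p → Fin k → ℤ
    base i t j = v j + + m * level i t j

    opaque
      cycle : Fin p → Fin p → Fin N → Cyc k N
      cycle i t g j = fromℤ N (toℤ g + base i t j)

      toℤ-cycle : ∀ i t g j → toℤ (cycle i t g j) ≡ toℤ g + base i t j mod N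
      toℤ-cycle i t g j = toℤ-fromℤ (toℤ g + base i t j)

      cycle≡ : ∀ {i t g j x} → toℤ g + base i t j ≡ toℤ x mod N → cycle i t g j ≡ x
      cycle≡ = mod⇒fromℤ≡

    Δbase : ∀ i t j → Δ (base i t) j ≡ Δ v j + + m * slope i t j
    Δbase i t j =
      expand (v (nextIx j)) (v j) (+ m) (A (nextIx j)) (A j) (B (nextIx j)) (B j) (toℤ t) (toℤ i)
      where
      expand : ∀ v′ v m a′ a b′ b t i →
        (v′ + m * (a′ * t + b′ * i)) - (v + m * (a * t + b * i))
        ≡ (v′ - v) + m * ((a′ - a) * t + (b′ - b) * i)
      expand = solve-∀

    Δcycle : ∀ i t g j → Δ (toℤ ∘ cycle i t g) j ≡ Δ v j + + m * slope i t j mod N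
    Δcycle i t g j = begin
      Δ (toℤ ∘ cycle i t g) j                                ≈⟨ minus-cong-mod (toℤ-cycle i t g (nextIx j))
                                                                                (toℤ-cycle i t g j) ⟩
      (toℤ g + base i t (nextIx j)) - (toℤ g + base i t j)   ≡⟨ cancel (toℤ g) (base i t (nextIx j))
                                                                       (base i t j) ⟩
      Δ (base i t) j                                         ≡⟨ Δbase i t j ⟩
      Δ v j + + m * slope i t j                              ∎
      where
      open ModReasoning N
      cancel : ∀ g b′ b → (g + b′) - (g + b) ≡ b′ - b
      cancel = solve-∀

    toℤ-cycle-mod-m : ∀ i t g j → toℤ (cycle i t g j) ≡ toℤ g + v j mod m
    toℤ-cycle-mod-m i t g j = mod-trans (mod-weakenˡ m p (toℤ-cycle i t g j))
      (+-cong-mod (mod-refl {a = toℤ g}) (+-multiple-mod (v j) (level i t j)))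

    congruent-vertices : ∀ i t g j j′ →
      toℤ (cycle i t g j) ≡ toℤ (cycle i t g j′) mod m → v j ≡ v j′ mod m
    congruent-vertices i t g j j′ h = +-cancelˡ-mod (toℤ g)
      (mod-trans (mod-sym (toℤ-cycle-mod-m i t g j)) (mod-trans h (toℤ-cycle-mod-m i t g j′)))

    cycle-isKCycle : ∀ i t g → IsKCycleIn m p k (cycle i t g)
    cycle-isKCycle i t g = injective , λ j →
      incongruent⇒adjacent m p {cycle i t g j} {cycle i t g (nextIx j)} (step-incongruent j)
      where
      injective : ∀ {j j′} → cycle i t g j ≡ cycle i t g j′ → j ≡ j′
      injective {j} {j′} eq = vertices-distinct (congruent-vertices i t g j j′ (mod-reflexive (cong toℤ eq)))
      step-incongruent : ∀ j → ¬ (toℤ (cycle i t g j) ≡ toℤ (cycle i t g (nextIx j)) mod m)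
      step-incongruent j h = forward≢backward (proj₂ (differences-distinct {j} {j} {forward} {backward}
                               (mod-trans Δv≡0 (mod-sym (neg-cong-mod Δv≡0)))))
        where
        Δv≡0 : Δ v j ≡ + 0 mod m
        Δv≡0 = mod-trans (minus-cong-mod (mod-sym (congruent-vertices i t g j (nextIx j) h)) (mod-refl {a = v j}))
                         (mod-reflexive (ℤ.+-inverseʳ (v j)))

    edge-difference : ∀ {i t g x y} (E : OrientedEdge (cycle i t g) x y) →
      toℤ y - toℤ x ≡ signed (orientation E) (Δ v (position E) + + m * slope i t (position E)) mod N
    edge-difference {i} {t} {g} E = mod-trans (mod-reflexive (oriented-difference E))
      (signed-cong-mod (orientation E) (Δcycle i t g (position E)))

    edge-difference-mod-m : ∀ {i t g x y} (E : OrientedEdge (cycle i t g) x y) →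
      toℤ y - toℤ x ≡ signed (orientation E) (Δ v (position E)) mod m
    edge-difference-mod-m E = mod-trans (mod-weakenˡ m p (edge-difference E))
      (signed-cong-mod (orientation E) (+-multiple-mod _ _))

    position-determined : ∀ {i t g i′ t′ g′ x y}
      (E : OrientedEdge (cycle i t g) x y) (E′ : OrientedEdge (cycle i′ t′ g′) x y) →
      position E ≡ position E′ × orientation E ≡ orientation E′
    position-determined E E′ =
      differences-distinct (mod-trans (mod-sym (edge-difference-mod-m E)) (edge-difference-mod-m E′))

    slope-determined : ∀ {i t g i′ t′ g′ x y}
      (E : OrientedEdge (cycle i t g) x y) (E′ : OrientedEdge (cycle i′ t′ g′) x y) →
      + p ∣ slope i t (position E) - slope i′ t′ (position E)
    slope-determined E E′ = at-same-position E E′ (position-determined E E′)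
      where
      at-same-position : ∀ {i t g i′ t′ g′ x y}
        (E : OrientedEdge (cycle i t g) x y) (E′ : OrientedEdge (cycle i′ t′ g′) x y) →
        position E ≡ position E′ × orientation E ≡ orientation E′ →
        + p ∣ slope i t (position E) - slope i′ t′ (position E)
      at-same-position E E′@(oriented-edge _ _ _ _) (refl , refl) =
        divides-difference (*-cancelˡ-mod m p (+-cancelˡ-mod (Δ v (position E))
          (signed-injective-mod (orientation E) (mod-trans (mod-sym (edge-difference E)) (edge-difference E′)))))

    parameter-determined : ∀ {i t g t′ g′ x y}
      (E : OrientedEdge (cycle i t g) x y) (E′ : OrientedEdge (cycle i t′ g′) x y) → t ≡ t′
    parameter-determined {i} {t} {t′ = t′} E E′ =
      [ (λ p∣ΔA → contradiction p∣ΔA (slope-nonzero j)) , ∣-difference⇒≡ ]′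
      (prime-∣-* p-prime (subst (+ p ∣_) (factor (Δ A j) (Δ B j) (toℤ t) (toℤ t′) (toℤ i))
                                          (slope-determined E E′)))
      where
      j = position E
      factor : ∀ a b t t′ i → (a * t + b * i) - (a * t′ + b * i) ≡ a * (t - t′)
      factor = solve-∀

    edge-unique : ∀ {i t g t′ g′ x y}
      (E : OrientedEdge (cycle i t g) x y) (E′ : OrientedEdge (cycle i t′ g′) x y) → t ≡ t′ × g ≡ g′
    edge-unique E E′ = at-same-position E E′ (position-determined E E′) (parameter-determined E E′)
      where
      at-same-position : ∀ {i t g t′ g′ x y}
        (E : OrientedEdge (cycle i t g) x y) (E′ : OrientedEdge (cycle i t′ g′) x y) →
        position E ≡ position E′ × orientation E ≡ orientation E′ → t ≡ t′ → t ≡ t′ × g ≡ g′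
      at-same-position {i} {t} {g} {g′ = g′} E E′@(oriented-edge _ _ _ _) (refl , refl) refl =
        refl , ∣-difference⇒≡ (subst (+ N ∣_) (cancel (toℤ g) (toℤ g′) (base i t j))
                 (divides-difference (mod-trans (mod-sym (toℤ-cycle i t g j))
                   (mod-trans (mod-reflexive (cong toℤ (trans (at-source E) (sym (at-source E′)))))
                              (toℤ-cycle i t g′ j)))))
        where
        j = position E
        cancel : ∀ g g′ b → (g + b) - (g′ + b) ≡ g - g′
        cancel = solve-∀

    same-family : ∀ {i t i′ t′ j l} → j ≢ l →
      + p ∣ slope i t j - slope i′ t′ j → + p ∣ slope i t l - slope i′ t′ l → i ≡ i′
    same-family {i} {t} {i′} {t′} {j} {l} j≢l p∣dⱼ p∣dₗ =
      [ (λ p∣det → contradiction p∣det (slopes-independent j≢l)) , ∣-difference⇒≡ ]′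
      (prime-∣-* p-prime (subst (+ p ∣_) eliminate-t
        (∣m∣n⇒∣m-n (∣n⇒∣m*n (Δ A j) p∣dₗ) (∣n⇒∣m*n (Δ A l) p∣dⱼ))))
      where
      eliminate-t : Δ A j * (slope i t l - slope i′ t′ l) - Δ A l * (slope i t j - slope i′ t′ j)
                  ≡ (Δ A j * Δ B l - Δ A l * Δ B j) * (toℤ i - toℤ i′)
      eliminate-t = identity (Δ A j) (Δ B j) (Δ A l) (Δ B l) (toℤ t) (toℤ t′) (toℤ i) (toℤ i′)
        where
        identity : ∀ aⱼ bⱼ aₗ bₗ t t′ i i′ →
          aⱼ * ((aₗ * t + bₗ * i) - (aₗ * t′ + bₗ * i′)) - aₗ * ((aⱼ * t + bⱼ * i) - (aⱼ * t′ + bⱼ * i′))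
          ≡ (aⱼ * bₗ - aₗ * bⱼ) * (i - i′)
        identity = solve-∀

    cycles-orthogonal : ∀ {i t g i′ t′ g′ x y u w} → i ≢ i′ →
      OrientedEdge (cycle i t g) x y → OrientedEdge (cycle i′ t′ g′) x y →
      OrientedEdge (cycle i t g) u w → OrientedEdge (cycle i′ t′ g′) u w →
      (x ≡ u × y ≡ w) ⊎ (x ≡ w × y ≡ u)
    cycles-orthogonal i≢i′ E₁ E₂ E₃ E₄ = by-positions (position E₁ Fin.≟ position E₃)
      where
      by-positions : Dec (position E₁ ≡ position E₃) → _
      by-positions (yes same)  = same-position⇒same-edge E₁ E₃ same
      by-positions (no differ) =
        contradiction (same-family differ (slope-determined E₁ E₂) (slope-determined E₃ E₄)) i≢i′

    slope-solvable : ∀ i j q → ∃ λ t → slope i t j ≡ q mod p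
    slope-solvable i j q =
      map₂ complete (linear-congruence-solvable p-prime (slope-nonzero j) (q - Δ B j * toℤ i))
      where
      complete : ∀ {t} → Δ A j * toℤ t ≡ q - Δ B j * toℤ i mod p → slope i t j ≡ q mod p
      complete h = mod-trans (+-cong-mod h mod-refl) (mod-reflexive (cancel q (Δ B j * toℤ i)))
        where
        cancel : ∀ q b → q - b + b ≡ q
        cancel = solve-∀

    step-solvable : ∀ i j δ → δ ≡ Δ v j mod m → ∃ λ t → Δ (base i t) j ≡ δ mod N
    step-solvable i j δ (congruent (divides q δ-Δv≡qm)) = map₂ raise (slope-solvable i j q)
      where
      raise : ∀ {t} → slope i t j ≡ q mod p → Δ (base i t) j ≡ δ mod N
      raise {t} h = begin
        Δ (base i t) j               ≡⟨ Δbase i t j ⟩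
        Δ v j + + m * slope i t j    ≈⟨ +-cong-mod (mod-refl {a = Δ v j}) (*-monoˡ-mod m p h) ⟩
        Δ v j + + m * q              ≡⟨ cong (_+_ (Δ v j)) (trans (ℤ.*-comm (+ m) q) (sym δ-Δv≡qm)) ⟩
        Δ v j + (δ - Δ v j)          ≡⟨ cancel (Δ v j) δ ⟩
        δ                            ∎
        where
        open ModReasoning N
        cancel : ∀ d δ → d + (δ - d) ≡ δ
        cancel = solve-∀

    translate-to-edge : ∀ i t j o x y → Δ (base i t) j ≡ signed o (toℤ y - toℤ x) mod N →
      ∃ λ g → OrientedEdge (cycle i t g) x y
    translate-to-edge i t j o x y step≡ = g , oriented-edge j o (cycle≡ at-start) (cycle≡ at-finish)
      where
      open ModReasoning N
      s = toℤ (source o x y)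
      g = fromℤ N (s - base i t j)
      at-start : toℤ g + base i t j ≡ s mod N
      at-start = begin
        toℤ g + base i t j           ≈⟨ +-cong-mod (toℤ-fromℤ (s - base i t j)) (mod-refl {a = base i t j}) ⟩
        s - base i t j + base i t j  ≡⟨ cancel s (base i t j) ⟩
        s                            ∎
        where
        cancel : ∀ s b → s - b + b ≡ s
        cancel = solve-∀
      at-finish : toℤ g + base i t (nextIx j) ≡ toℤ (target o x y) mod N
      at-finish = begin
        toℤ g + base i t (nextIx j)            ≡⟨ regroup (toℤ g) (base i t j) (base i t (nextIx j)) ⟩
        (toℤ g + base i t j) + Δ (base i t) j  ≈⟨ +-cong-mod at-start step≡ ⟩
        s + signed o (toℤ y - toℤ x)           ≡⟨ source+signed o x y ⟩
        toℤ (target o x y)                     ∎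
        where
        regroup : ∀ g b b′ → g + b′ ≡ (g + b) + (b′ - b)
        regroup = solve-∀

    edge-exists : ∀ i {x y} → Adjacent m p x y → ∃₂ λ t g → OrientedEdge (cycle i t g) x y
    edge-exists i {x} {y} adjacent =
      let j , o , r≡ = differences-cover (toℤ y - toℤ x) incongruent
          t , step≡  = step-solvable i j (signed o (toℤ y - toℤ x)) (signed-transpose-mod o r≡)
      in  t , translate-to-edge i t j o x y step≡
      where
      incongruent : ¬ (+ m ∣ toℤ y - toℤ x)
      incongruent h = adjacent⇒incongruent m p adjacent (mod-sym (congruent h))

    shift-cycle : ∀ i t g h j → shift h (cycle i t g) j ≡ cycle i t (fromℤ N (toℤ g + toℤ h)) j
    shift-cycle i t g h j = trans (addMod≡fromℤ (cycle i t g j) h) (sym (cycle≡ (begin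
      toℤ (fromℤ N (toℤ g + toℤ h)) + base i t j   ≈⟨ +-cong-mod (toℤ-fromℤ (toℤ g + toℤ h))
                                                                  (mod-refl {a = base i t j}) ⟩
      (toℤ g + toℤ h) + base i t j                 ≡⟨ swap (toℤ g) (toℤ h) (base i t j) ⟩
      toℤ g + base i t j + toℤ h                   ≈⟨ +-cong-mod (toℤ-cycle i t g j) (mod-refl {a = toℤ h}) ⟨
      toℤ (cycle i t g j) + toℤ h                  ≈⟨ toℤ-fromℤ (toℤ (cycle i t g j) + toℤ h) ⟨
      toℤ (fromℤ N (toℤ (cycle i t g j) + toℤ h))  ∎)))
      where
      open ModReasoning N
      swap : ∀ g h b → (g + h) + b ≡ g + b + h
      swap = solve-∀

    family : Fin p → List (Cyc k N)
    family i = tabulate (uncurry (cycle i) ∘ Fin.remQuot {p} N)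

    family-combine : ∀ i t g → uncurry (cycle i) (Fin.remQuot {p} N (Fin.combine t g)) ≡ cycle i t g
    family-combine i t g = cong (uncurry (cycle i)) (Fin.remQuot-combine {p} {N} t g)

    ∈-family⁻ : ∀ {i c} → c ∈ family i → ∃₂ λ t g → c ≡ cycle i t g
    ∈-family⁻ c∈ =
      let a , c≡ = ∈-tabulate⁻ c∈ in proj₁ (Fin.remQuot {p} N a) , proj₂ (Fin.remQuot {p} N a) , c≡

    family-isCyclicDecomposition : ∀ i → IsCyclicKCycleDecomp m p k (family i)
    family-isCyclicDecomposition i =
      (All.tabulate⁺ (λ _ → cycle-isKCycle i _ _) , exactly-once) , translation-closed
      where
      exactly-once : ∀ x y → Adjacent m p x y → ExactlyOne (λ c → EdgeOf c x y) (family i)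
      exactly-once x y adjacent =
        let t , g , E = edge-exists i adjacent
        in exactlyOne-tabulate (uncurry (cycle i) ∘ Fin.remQuot {p} N) {λ c → EdgeOf c x y} (Fin.combine t g)
             (subst (λ c → EdgeOf c x y) (sym (family-combine i t g)) (unorient E))
             λ b e → let t≡ , g≡ = edge-unique (orient e) E
                     in trans (sym (Fin.combine-remQuot {p} N b)) (cong₂ Fin.combine t≡ g≡)
      translation-closed : IsCyclic (family i)
      translation-closed c c∈ h =
        let t , g , c≡ = ∈-family⁻ c∈
            g′ = fromℤ N (toℤ g + toℤ h)
        in subst (λ c → Any (SameCycle (shift h c)) (family i)) (sym c≡)
             (Any.tabulate⁺ {P = SameCycle (shift h (cycle i t g))} (Fin.combine t g′)
               (pointwise⇒sameCycle λ j →
                 trans (shift-cycle i t g h j) (cong (λ c → c j) (sym (family-combine i t g′)))))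

    families-orthogonal : ∀ i i′ → i ≢ i′ → Orthogonal (family i) (family i′)
    families-orthogonal i i′ i≢i′ c c′ c∈ c′∈ x y u w e₁ e₂ e₃ e₄ =
      let t , g , c≡ = ∈-family⁻ c∈
          t′ , g′ , c′≡ = ∈-family⁻ c′∈
          edge : ∀ {c d : Cyc k N} {x y} → c ≡ d → EdgeOf c x y → OrientedEdge d x y
          edge c≡d e = orient (subst (λ c → EdgeOf c _ _) c≡d e)
      in cycles-orthogonal i≢i′ (edge c≡ e₁) (edge c′≡ e₂) (edge c≡ e₃) (edge c′≡ e₄)

module SignedLengths where

  open import Data.Integer using (_+_; _*_; -_; _-_)
  open Congruence
  open CycleEdges
  open Lifting

  module _ {k : ℕ} where

    private
      m : ℕ
      m = 2 ℕ.* k ℕ.+ 1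

      instance
        m≢0 : NonZero m
        m≢0 = ℕ.>-nonZero (ℕ.m≤n+m 1 (2 ℕ.* k))

      m≡ : m ≡ suc (k ℕ.+ k)
      m≡ = double k
        where
        double : ∀ k → 2 ℕ.* k ℕ.+ 1 ≡ suc (k ℕ.+ k)
        double = ℕ-solver.solve-∀

      k+k<m : k ℕ.+ k < m
      k+k<m = ℕ.≤-reflexive (sym m≡)

      k<m : k < m
      k<m = ℕ.≤-<-trans (ℕ.m≤m+n k k) k+k<m

    length : Fin k → ℕ
    length a = k ∸ toℕ a

    length≡ : ∀ a → + k - toℤ a ≡ + length a
    length≡ a = trans (ℤ.m-n≡m⊖n k (toℕ a)) (ℤ.⊖-≥ (ℕ.<⇒≤ (Fin.toℕ<n a)))

    0<length : ∀ a → 0 < length a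
    0<length a = ℕ.m<n⇒0<n∸m (Fin.toℕ<n a)

    length<m : ∀ a → length a < m
    length<m a = ℕ.≤-<-trans (ℕ.m∸n≤m k (toℕ a)) k<m

    length-injective : ∀ {a b} → + length a ≡ + length b mod m → a ≡ b
    length-injective {a} {b} h = Fin.toℕ-injective
      (ℕ.∸-cancelˡ-≡ (ℕ.<⇒≤ (Fin.toℕ<n a)) (ℕ.<⇒≤ (Fin.toℕ<n b)) (mod-unique (length<m a) (length<m b) h))

    lengths-not-opposite : ∀ a b → ¬ (+ length a ≡ - + length b mod m)
    lengths-not-opposite a b h = ℕ.<⇒≢ (ℕ.<-≤-trans (0<length a) (ℕ.m≤m+n (length a) (length b)))
      (sym (mod-unique sum<m (ℕ.≤-<-trans ℕ.z≤n k<m)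
        (mod-trans (+-cong-mod h mod-refl) (mod-reflexive (ℤ.+-inverseˡ (+ length b))))))
      where
      sum<m : length a ℕ.+ length b < m
      sum<m = ℕ.≤-<-trans (ℕ.+-mono-≤ (ℕ.m∸n≤m k (toℕ a)) (ℕ.m∸n≤m k (toℕ b))) k+k<m

    signed-lengths-distinct : ∀ {a b} o o′ →
      signed o (+ length a) ≡ signed o′ (+ length b) mod m → a ≡ b × o ≡ o′
    signed-lengths-distinct         forward  forward  h = length-injective h , refl
    signed-lengths-distinct         backward backward h = length-injective (signed-injective-mod backward h) , refl
    signed-lengths-distinct {a} {b} forward  backward h = contradiction h (lengths-not-opposite a b)
    signed-lengths-distinct {a} {b} backward forward  h = contradiction (mod-sym h) (lengths-not-opposite b a)

    length-of : ∀ {n} → 0 < n → n ≤ k → ∃ λ a → length a ≡ n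
    length-of {n} 0<n n≤k = fromℕ< a<k , trans (cong (k ∸_) (Fin.toℕ-fromℕ< a<k)) (ℕ.m∸[m∸n]≡n n≤k)
      where
      a<k : k ∸ n < k
      a<k = ℕ.∸-monoʳ-< 0<n n≤k

    signed-length-of : ∀ n → 0 < n → n < m → ∃₂ λ a o → + n ≡ signed o (+ length a) mod m
    signed-length-of n 0<n n<m with n ℕ.≤? k
    ... | yes n≤k = let a , length≡n = length-of 0<n n≤k
                    in a , forward , mod-reflexive (cong +_ (sym length≡n))
    ... | no  n≰k = let a , length≡m-n = length-of (ℕ.m<n⇒0<n∸m n<m) m-n≤k
                    in a , backward , mod-trans n≡-[m-n] (mod-reflexive (cong (-_ ∘ +_) (sym length≡m-n)))
      where
      m-n≤k : m ∸ n ≤ k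
      m-n≤k = ℕ.≤-trans (ℕ.∸-monoʳ-≤ m (ℕ.≰⇒> n≰k)) (ℕ.≤-reflexive (trans (cong (_∸ suc k) m≡) (ℕ.m+n∸m≡n k k)))
      n≡-[m-n] : + n ≡ - + (m ∸ n) mod m
      n≡-[m-n] = congruent (divides (+ 1) (begin
        + n - - + (m ∸ n)      ≡⟨ cong (_+_ (+ n)) (ℤ.neg-involutive (+ (m ∸ n))) ⟩
        + (n ℕ.+ (m ∸ n))      ≡⟨ cong +_ (ℕ.m+[n∸m]≡n (ℕ.<⇒≤ n<m)) ⟩
        + m                    ≡⟨ ℤ.*-identityˡ (+ m) ⟨
        + 1 * + m              ∎))
        where open ≡-Reasoning

    residue-signed-length : ∀ r → ¬ (+ m ∣ r) → ∃₂ λ a o → r ≡ signed o (+ length a) mod m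
    residue-signed-length r m∤r =
      let a , o , ρ≡ = signed-length-of ρ 0<ρ (Fin.toℕ<n (fromℤ m r))
      in a , o , mod-trans r≡ρ ρ≡
      where
      ρ = toℕ (fromℤ m r)
      r≡ρ : r ≡ + ρ mod m
      r≡ρ = mod-sym (toℤ-fromℤ r)
      0<ρ : 0 < ρ
      0<ρ = ℕ.n≢0⇒n>0 λ ρ≡0 →
        m∤r (subst (+ m ∣_) (ℤ.+-identityʳ r) (divides-difference (subst (λ ρ → r ≡ + ρ mod m) ρ≡0 r≡ρ)))

    distinct-lengths⇒isBaseCycle : ∀ {v : Fin k → ℤ} (rank : Fin k → Fin k) →
      (∀ {j j′} → v j ≡ v j′ mod m → j ≡ j′) → Injective _≡_ _≡_ rank →
      (∀ j → ∃ λ o → Δ v j ≡ signed o (+ k - toℤ (rank j)) mod m) → IsBaseCycle m k v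
    distinct-lengths⇒isBaseCycle {v} rank vertices-distinct rank-injective edge-length = record
      { vertices-distinct    = vertices-distinct
      ; differences-distinct = differences-distinct
      ; differences-cover    = differences-cover
      }
      where
      σ : Fin k → Orientation
      σ j = proj₁ (edge-length j)
      Δ≡ : ∀ j → Δ v j ≡ signed (σ j) (+ length (rank j)) mod m
      Δ≡ j = mod-trans (proj₂ (edge-length j)) (mod-reflexive (cong (signed (σ j)) (length≡ (rank j))))
      signed-Δ : ∀ o j → signed o (Δ v j) ≡ signed (o · σ j) (+ length (rank j)) mod m
      signed-Δ o j = mod-trans (signed-cong-mod o (Δ≡ j)) (mod-reflexive (sym (signed-· o (σ j) _)))
      differences-distinct : ∀ {j j′ o o′} → signed o (Δ v j) ≡ signed o′ (Δ v j′) mod m →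
                             j ≡ j′ × o ≡ o′
      differences-distinct {j} {j′} {o} {o′} h =
        let rank≡ , orientation≡ = signed-lengths-distinct (o · σ j) (o′ · σ j′)
                                     (mod-trans (mod-sym (signed-Δ o j)) (mod-trans h (signed-Δ o′ j′)))
            j≡j′ = rank-injective rank≡
        in j≡j′ , ·-cancelʳ (σ j′) (subst (λ j → o · σ j ≡ o′ · σ j′) j≡j′ orientation≡)
      differences-cover : ∀ r → ¬ (+ m ∣ r) → ∃₂ λ j o → r ≡ signed o (Δ v j) mod m
      differences-cover r m∤r =
        let a , o , r≡ = residue-signed-length r m∤r
            j , rank-j≡a = injective⇒surjective rank rank-injective a
        in j , o · σ j , mod-trans r≡ (mod-sym (mod-trans (mod-reflexive (signed-· o (σ j) (Δ v j)))
                           (signed-cong-mod o (mod-trans (signed-transpose-mod (σ j) (Δ≡ j))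
                             (mod-reflexive (cong (+_ ∘ length) rank-j≡a))))))

module BaseCycle where

  open import Data.Integer using (_+_; _*_; -_; _-_)
  open Congruence
  open CycleEdges
  open Lifting
  open SignedLengths

  data Half : ℕ → Set where
    even : ∀ a → Half (a ℕ.+ a)
    odd  : ∀ a → Half (suc (a ℕ.+ a))

  half : ∀ n → Half n
  half zero = even 0
  half (suc n) with half n
  ... | even a = odd a
  ... | odd  a = subst Half (cong suc (ℕ.+-suc a a)) (even (suc a))

  ⌊suc[n+n]/2⌋≡n : ∀ n → ⌊ suc (n ℕ.+ n) /2⌋ ≡ n
  ⌊suc[n+n]/2⌋≡n n = sym (ℕ.n≡⌈n+n/2⌉ n)

  n+n≤suc[m+m]⇒n≤m : ∀ {n m} → n ℕ.+ n ≤ suc (m ℕ.+ m) → n ≤ m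
  n+n≤suc[m+m]⇒n≤m {n} {m} h = subst₂ _≤_ (sym (ℕ.n≡⌊n+n/2⌋ n)) (⌊suc[n+n]/2⌋≡n m) (ℕ.⌊n/2⌋-mono h)

  ⌊n/2⌋+⌊n/2⌋≤n : ∀ n → ⌊ n /2⌋ ℕ.+ ⌊ n /2⌋ ≤ n
  ⌊n/2⌋+⌊n/2⌋≤n n =
    ℕ.≤-trans (ℕ.+-monoʳ-≤ ⌊ n /2⌋ (ℕ.⌊n/2⌋≤⌈n/2⌉ n)) (ℕ.≤-reflexive (ℕ.⌊n/2⌋+⌈n/2⌉≡n n))

  n<m+m⇒⌊n/2⌋<m : ∀ {n m} → n < m ℕ.+ m → ⌊ n /2⌋ < m
  n<m+m⇒⌊n/2⌋<m {n} h = ℕ.≰⇒> λ m≤ → ℕ.<⇒≱ h (ℕ.≤-trans (ℕ.+-mono-≤ m≤ m≤) (⌊n/2⌋+⌊n/2⌋≤n n))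

  m+m≤n⇒m≤⌊n/2⌋ : ∀ {n m} → m ℕ.+ m ≤ n → m ≤ ⌊ n /2⌋
  m+m≤n⇒m≤⌊n/2⌋ {n} {m} h = subst (_≤ ⌊ n /2⌋) (sym (ℕ.n≡⌊n+n/2⌋ m)) (ℕ.⌊n/2⌋-mono h)

  interleave : (ℕ → ℕ) → (ℕ → ℕ) → ℕ → ℕ
  interleave f g zero    = f zero
  interleave f g (suc n) = interleave g (f ∘ suc) n

  interleave-even : ∀ f g a → interleave f g (a ℕ.+ a) ≡ f a
  interleave-even f g zero    = refl
  interleave-even f g (suc a) =
    trans (cong (interleave g (f ∘ suc)) (ℕ.+-suc a a)) (interleave-even (f ∘ suc) (g ∘ suc) a)

  interleave-odd : ∀ f g a → interleave f g (suc (a ℕ.+ a)) ≡ g a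
  interleave-odd f g = interleave-even g (f ∘ suc)

  first-edge-length : ∀ k c → c ≤ 1 →
    ∃ λ o → + suc k - + (1 ∸ c) ≡ signed o (+ k - + 0) mod (2 ℕ.* k ℕ.+ 1)
  first-edge-length k zero          _        = forward , mod-reflexive (cancel (+ k))
    where
    cancel : ∀ k → (+ 1 + k) - + 1 ≡ k - + 0
    cancel = solve-∀
  first-edge-length k (suc zero)    _        = backward , congruent (divides (+ 1) (wrap (+ k)))
    where
    wrap : ∀ k → (+ 1 + k) - + 0 - - (k - + 0) ≡ + 1 * (k + (k + + 0) + + 1)
    wrap = solve-∀
  first-edge-length k (suc (suc c)) (s≤s ())

  -- For k = 4s + 3 + 2c + r the cycle is 1 − c, k + 1, 2, k, 3, k − 1, …: the high
  -- vertices hi decrease by one, the low vertices lo increase by one except for a jump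
  -- by two after s steps. The edges starting at positions 0, 1, 2, … thus have lengths
  -- k, k − 1, k − 2, …, except that the length k − 1 − 2s is skipped, and the closing
  -- edge has exactly that length. The edge at position n has length k − rank n.
  module ZigzagCycle (s c r : ℕ) (c≤1 : c ≤ 1) where

    k : ℕ
    k = 3 ℕ.+ (s ℕ.+ s) ℕ.+ (s ℕ.+ s) ℕ.+ (c ℕ.+ c) ℕ.+ r

    skip : ℕ → ℕ
    skip a with a ℕ.<? s
    ... | yes _ = 0
    ... | no  _ = 1

    skip-< : ∀ {a} → a < s → skip a ≡ 0
    skip-< {a} a<s with a ℕ.<? s
    ... | yes _   = refl
    ... | no  a≮s = contradiction a<s a≮s

    skip-≥ : ∀ {a} → s ≤ a → skip a ≡ 1
    skip-≥ {a} s≤a with a ℕ.<? s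
    ... | yes a<s = contradiction s≤a (ℕ.<⇒≱ a<s)
    ... | no  _   = refl

    skip≤1 : ∀ a → skip a ≤ 1
    skip≤1 a with a ℕ.<? s
    ... | yes _ = z≤n
    ... | no  _ = s≤s z≤n

    hi lo : ℕ → ℕ
    hi a = suc k ∸ a
    lo a = 2 ℕ.+ a ℕ.+ skip a

    vertex : ℕ → ℕ
    vertex zero    = 1 ∸ c
    vertex (suc n) = interleave hi lo n

    extra : ℕ → ℕ
    extra zero    = 0
    extra (suc n) = skip ⌊ n /2⌋

    rank : ℕ → ℕ
    rank n with suc n ℕ.≟ k
    ... | yes _ = suc (s ℕ.+ s)
    ... | no  _ = n ℕ.+ extra n

    rank-inner : ∀ {n} → suc n < k → rank n ≡ n ℕ.+ extra n
    rank-inner {n} inner with suc n ℕ.≟ k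
    ... | yes last = contradiction last (ℕ.<⇒≢ inner)
    ... | no  _    = refl

    rank-last : ∀ {n} → suc n ≡ k → rank n ≡ suc (s ℕ.+ s)
    rank-last {n} last with suc n ℕ.≟ k
    ... | yes _     = refl
    ... | no  inner = contradiction last inner

    vertex-high : ∀ a → vertex (suc (a ℕ.+ a)) ≡ hi a
    vertex-high = interleave-even hi lo

    vertex-low : ∀ a → vertex (suc (suc (a ℕ.+ a))) ≡ lo a
    vertex-low = interleave-odd hi lo

    a<k : ∀ {a} → suc (a ℕ.+ a) < k → a < k
    a<k {a} h = ℕ.≤-<-trans (ℕ.≤-trans (ℕ.m≤m+n a a) (ℕ.n≤1+n _)) h

    a≤suc-k : ∀ {a} → suc (a ℕ.+ a) < k → a ≤ suc k
    a≤suc-k {a} h = ℕ.≤-trans (ℕ.<⇒≤ (a<k {a} h)) (ℕ.n≤1+n k)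

    hi≡ : ∀ {a} → a ≤ suc k → + hi a ≡ + suc k - + a
    hi≡ {a} a≤ = sym (trans (ℤ.m-n≡m⊖n (suc k) a) (ℤ.⊖-≥ a≤))

    hi+a≡suc-k : ∀ {a} → a ≤ suc k → hi a ℕ.+ a ≡ suc k
    hi+a≡suc-k = ℕ.m∸n+n≡m

    lo≤ : ∀ a → lo a ≤ 3 ℕ.+ a
    lo≤ a = subst (lo a ≤_) (ℕ.+-comm (2 ℕ.+ a) 1) (ℕ.+-monoʳ-≤ (2 ℕ.+ a) (skip≤1 a))

    inner-edge-length : ∀ n → suc n < k →
      ∃ λ o → + vertex (suc n) - + vertex n ≡ signed o (+ k - + (n ℕ.+ extra n)) mod (2 ℕ.* k ℕ.+ 1)
    inner-edge-length zero    _     = first-edge-length k c c≤1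
    inner-edge-length (suc n) inner = from-half (half n) inner
      where
      open ≡-Reasoning
      from-half : ∀ {n} → Half n → suc (suc n) < k →
        ∃ λ o → + vertex (suc (suc n)) - + vertex (suc n)
                ≡ signed o (+ k - + (suc n ℕ.+ extra (suc n))) mod (2 ℕ.* k ℕ.+ 1)
      from-half (even a) inner = backward , mod-reflexive (begin
        + vertex (suc (suc (a ℕ.+ a))) - + vertex (suc (a ℕ.+ a))
          ≡⟨ cong₂ (λ x y → + x - + y) (vertex-low a) (vertex-high a) ⟩
        + lo a - + hi a
          ≡⟨ cong (_-_ (+ lo a)) (hi≡ (a≤suc-k {a} (ℕ.<-trans (ℕ.n<1+n _) inner))) ⟩
        + lo a - (+ suc k - + a)
          ≡⟨ descend (+ k) (+ a) (+ skip a) ⟩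
        - (+ k - + (suc (a ℕ.+ a) ℕ.+ skip a))
          ≡⟨ cong (λ a′ → - (+ k - + (suc (a ℕ.+ a) ℕ.+ skip a′))) (ℕ.n≡⌊n+n/2⌋ a) ⟩
        - (+ k - + (suc (a ℕ.+ a) ℕ.+ extra (suc (a ℕ.+ a))))
          ∎)
        where
        descend : ∀ k a d → (+ 2 + a + d) - ((+ 1 + k) - a) ≡ - (k - (+ 1 + (a + a) + d))
        descend = solve-∀
      from-half (odd a) inner = forward , mod-reflexive (begin
        + vertex (suc (suc (suc (a ℕ.+ a)))) - + vertex (suc (suc (a ℕ.+ a)))
          ≡⟨ cong₂ (λ x y → + x - + y) (trans (cong (vertex ∘ suc ∘ suc) (sym (ℕ.+-suc a a)))
                                               (vertex-high (suc a)))
                                        (vertex-low a) ⟩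
        + hi (suc a) - + lo a
          ≡⟨ cong (_- + lo a) (hi≡ (a≤suc-k {suc a} (subst (_< k) (cong (suc ∘ suc) (sym (ℕ.+-suc a a)))
                                                                  inner))) ⟩
        (+ suc k - + suc a) - + lo a
          ≡⟨ ascend (+ k) (+ a) (+ skip a) ⟩
        + k - + (suc (suc (a ℕ.+ a)) ℕ.+ skip a)
          ≡⟨ cong (λ a′ → + k - + (suc (suc (a ℕ.+ a)) ℕ.+ skip a′)) (⌊suc[n+n]/2⌋≡n a) ⟨
        + k - + (suc (suc (a ℕ.+ a)) ℕ.+ extra (suc (suc (a ℕ.+ a))))
          ∎)
        where
        ascend : ∀ k a d → ((+ 1 + k) - (+ 1 + a)) - (+ 2 + a + d) ≡ k - (+ 2 + (a + a) + d)
        ascend = solve-∀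

    lo<hi : ∀ {a a′} → suc (a ℕ.+ a) < k → suc (suc (a′ ℕ.+ a′)) < k → lo a′ < hi a
    lo<hi {a} {a′} h h′ = ℕ.+-cancelʳ-< a (lo a′) (hi a) (begin-strict
      lo a′ ℕ.+ a         ≤⟨ ℕ.+-monoˡ-≤ a (lo≤ a′) ⟩
      3 ℕ.+ a′ ℕ.+ a      ≡⟨ ℕ.+-comm (3 ℕ.+ a′) a ⟩
      a ℕ.+ (3 ℕ.+ a′)    ≤⟨ n+n≤suc[m+m]⇒n≤m (ℕ.≤-trans (ℕ.≤-reflexive (regroup a a′)) (s≤s (ℕ.+-mono-≤ h h′))) ⟩
      k                   <⟨ ℕ.n<1+n k ⟩
      suc k               ≡⟨ hi+a≡suc-k (a≤suc-k {a} h) ⟨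
      hi a ℕ.+ a          ∎)
      where
      open ℕ.≤-Reasoning
      regroup : ∀ a a′ → (a ℕ.+ (3 ℕ.+ a′)) ℕ.+ (a ℕ.+ (3 ℕ.+ a′))
                         ≡ suc (suc (suc (a ℕ.+ a)) ℕ.+ suc (suc (suc (a′ ℕ.+ a′))))
      regroup = ℕ-solver.solve-∀

    lo-increasing : ∀ {a a′} → a < a′ → lo a < lo a′
    lo-increasing {a} {a′} a<a′ = by-cases (a′ ℕ.<? s)
      where
      open ℕ.≤-Reasoning
      by-cases : Dec (a′ < s) → lo a < lo a′
      by-cases (yes a′<s) = subst₂ _<_ (cong (2 ℕ.+ a ℕ.+_) (sym (skip-< (ℕ.<-trans a<a′ a′<s))))
                                        (cong (2 ℕ.+ a′ ℕ.+_) (sym (skip-< a′<s)))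
                                        (ℕ.+-monoˡ-< 0 (s≤s (s≤s a<a′)))
      by-cases (no a′≮s) = begin-strict
        lo a                    ≤⟨ lo≤ a ⟩
        3 ℕ.+ a                 ≤⟨ s≤s (s≤s a<a′) ⟩
        2 ℕ.+ a′                <⟨ ℕ.m<m+n (2 ℕ.+ a′) ℕ.z<s ⟩
        2 ℕ.+ a′ ℕ.+ 1          ≡⟨ cong (2 ℕ.+ a′ ℕ.+_) (skip-≥ (ℕ.≮⇒≥ a′≮s)) ⟨
        lo a′                   ∎

    lo-injective : ∀ {a a′} → lo a ≡ lo a′ → a ≡ a′
    lo-injective {a} {a′} eq with ℕ.<-cmp a a′
    ... | tri< a<a′ _ _ = contradiction eq (ℕ.<⇒≢ (lo-increasing a<a′))
    ... | tri≈ _ a≡a′ _ = a≡a′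
    ... | tri> _ _ a′<a = contradiction (sym eq) (ℕ.<⇒≢ (lo-increasing a′<a))

    data VertexKind : ℕ → Set where
      start : VertexKind 0
      high  : ∀ a → VertexKind (suc (a ℕ.+ a))
      low   : ∀ a → VertexKind (suc (suc (a ℕ.+ a)))

    vertex-kind : ∀ n → VertexKind n
    vertex-kind zero    = start
    vertex-kind (suc n) with half n
    ... | even a = high a
    ... | odd  a = low a

    start≤1 : vertex 0 ≤ 1
    start≤1 = ℕ.m∸n≤m 1 c

    start<hi : ∀ {a} → suc (a ℕ.+ a) < k → vertex 0 < hi a
    start<hi {a} h = ℕ.≤-<-trans start≤1 (ℕ.+-cancelʳ-≤ a 2 (hi a)
      (subst (2 ℕ.+ a ≤_) (sym (hi+a≡suc-k (a≤suc-k {a} h))) (s≤s (a<k {a} h))))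

    start<lo : ∀ a → vertex 0 < lo a
    start<lo a = ℕ.≤-<-trans start≤1 (ℕ.≤-trans (ℕ.m≤m+n 2 a) (ℕ.m≤m+n (2 ℕ.+ a) (skip a)))

    vertex-injective : ∀ {n n′} → n < k → n′ < k → vertex n ≡ vertex n′ → n ≡ n′
    vertex-injective {n} {n′} = by-kind (vertex-kind n) (vertex-kind n′)
      where
      by-kind : ∀ {n n′} → VertexKind n → VertexKind n′ → n < k → n′ < k → vertex n ≡ vertex n′ → n ≡ n′
      by-kind start    start     _ _  _  = refl
      by-kind start    (high a′) _ h′ eq = contradiction (trans eq (vertex-high a′)) (ℕ.<⇒≢ (start<hi {a′} h′))
      by-kind start    (low a′)  _ _  eq = contradiction (trans eq (vertex-low a′)) (ℕ.<⇒≢ (start<lo a′))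
      by-kind (high a) start     h _  eq = contradiction (trans (sym eq) (vertex-high a)) (ℕ.<⇒≢ (start<hi {a} h))
      by-kind (low a)  start     _ _  eq = contradiction (trans (sym eq) (vertex-low a)) (ℕ.<⇒≢ (start<lo a))
      by-kind (high a) (high a′) h h′ eq = cong (λ a → suc (a ℕ.+ a))
        (ℕ.∸-cancelˡ-≡ (a≤suc-k {a} h) (a≤suc-k {a′} h′) (trans (sym (vertex-high a)) (trans eq (vertex-high a′))))
      by-kind (low a)  (low a′)  _ _  eq = cong (λ a → suc (suc (a ℕ.+ a)))
        (lo-injective (trans (sym (vertex-low a)) (trans eq (vertex-low a′))))
      by-kind (high a) (low a′)  h h′ eq =
        contradiction (trans (sym (vertex-low a′)) (trans (sym eq) (vertex-high a))) (ℕ.<⇒≢ (lo<hi {a} {a′} h h′))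
      by-kind (low a)  (high a′) h h′ eq =
        contradiction (trans (sym (vertex-low a)) (trans eq (vertex-high a′))) (ℕ.<⇒≢ (lo<hi {a′} {a} h′ h))

    vertex<m : ∀ {n} → n < k → vertex n < 2 ℕ.* k ℕ.+ 1
    vertex<m {n} n<k = ℕ.≤-<-trans (below (vertex-kind n) n<k) suc-k<m
      where
      below : ∀ {n} → VertexKind n → n < k → vertex n ≤ suc k
      below start    _ = ℕ.≤-trans start≤1 (s≤s z≤n)
      below (high a) _ = subst (_≤ suc k) (sym (vertex-high a)) (ℕ.m∸n≤m (suc k) a)
      below (low a)  h = subst (_≤ suc k) (sym (vertex-low a))
        (ℕ.≤-trans (lo≤ a) (s≤s (ℕ.≤-trans (s≤s (s≤s (ℕ.m≤m+n a a))) (ℕ.<⇒≤ h))))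
      suc-k<m : suc k < 2 ℕ.* k ℕ.+ 1
      suc-k<m = subst (suc k <_) (sym (double k)) (ℕ.m<m+n (suc k) ℕ.z<s)
        where
        double : ∀ k → 2 ℕ.* k ℕ.+ 1 ≡ suc k ℕ.+ k
        double = ℕ-solver.solve-∀

    extra≤1 : ∀ n → extra n ≤ 1
    extra≤1 zero    = z≤n
    extra≤1 (suc n) = skip≤1 _

    rank-low : ∀ {n} → n ≤ s ℕ.+ s → n ℕ.+ extra n ≡ n
    rank-low {zero}  _ = refl
    rank-low {suc n} h = trans (cong (suc n ℕ.+_) (skip-< (n<m+m⇒⌊n/2⌋<m h))) (ℕ.+-identityʳ (suc n))

    rank-high : ∀ {n} → s ℕ.+ s < n → n ℕ.+ extra n ≡ suc n
    rank-high {suc n} h = trans (cong (suc n ℕ.+_) (skip-≥ (m+m≤n⇒m≤⌊n/2⌋ (ℕ.≤-pred h)))) (ℕ.+-comm (suc n) 1)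

    inner-rank-injective : ∀ {n n′} → n ℕ.+ extra n ≡ n′ ℕ.+ extra n′ → n ≡ n′
    inner-rank-injective {n} {n′} eq = by-cases (n ℕ.≤? s ℕ.+ s) (n′ ℕ.≤? s ℕ.+ s)
      where
      low≢suc-high : ∀ {n n′} → n ≤ s ℕ.+ s → s ℕ.+ s < n′ → n ≢ suc n′
      low≢suc-high l h n≡ = ℕ.<⇒≱ (ℕ.<-trans h (ℕ.n<1+n _)) (subst (_≤ s ℕ.+ s) n≡ l)
      by-cases : Dec (n ≤ s ℕ.+ s) → Dec (n′ ≤ s ℕ.+ s) → n ≡ n′
      by-cases (yes l) (yes l′) = trans (sym (rank-low l)) (trans eq (rank-low l′))
      by-cases (no  h) (no  h′) =
        ℕ.suc-injective (trans (sym (rank-high (ℕ.≰⇒> h))) (trans eq (rank-high (ℕ.≰⇒> h′))))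
      by-cases (yes l) (no  h′) =
        contradiction (trans (sym (rank-low l)) (trans eq (rank-high (ℕ.≰⇒> h′)))) (low≢suc-high l (ℕ.≰⇒> h′))
      by-cases (no  h) (yes l′) =
        contradiction (trans (sym (rank-low l′)) (trans (sym eq) (rank-high (ℕ.≰⇒> h)))) (low≢suc-high l′ (ℕ.≰⇒> h))

    inner-rank≢last : ∀ n → n ℕ.+ extra n ≢ suc (s ℕ.+ s)
    inner-rank≢last n eq with n ℕ.≤? s ℕ.+ s
    ... | yes l = ℕ.<⇒≱ (ℕ.n<1+n (s ℕ.+ s)) (subst (_≤ s ℕ.+ s) (trans (sym (rank-low l)) eq) l)
    ... | no  h = ℕ.<⇒≢ (ℕ.≰⇒> h) (sym (ℕ.suc-injective (trans (sym (rank-high (ℕ.≰⇒> h))) eq)))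

    rank<k : ∀ {n} → n < k → rank n < k
    rank<k {n} n<k with ℕ.m≤n⇒m<n∨m≡n n<k
    ... | inj₁ inner = subst (_< k) (sym (rank-inner inner))
      (ℕ.≤-<-trans (subst (n ℕ.+ extra n ≤_) (ℕ.+-comm n 1) (ℕ.+-monoʳ-≤ n (extra≤1 n))) inner)
    ... | inj₂ last  = subst (_< k) (sym (rank-last last)) (s≤s (s≤s (ℕ.≤-trans s+s≤ (ℕ.n≤1+n _))))
      where
      s+s≤ : s ℕ.+ s ≤ (s ℕ.+ s) ℕ.+ (s ℕ.+ s) ℕ.+ (c ℕ.+ c) ℕ.+ r
      s+s≤ = ℕ.≤-trans (ℕ.≤-trans (ℕ.m≤m+n (s ℕ.+ s) (s ℕ.+ s)) (ℕ.m≤m+n _ (c ℕ.+ c))) (ℕ.m≤m+n _ r)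

    rank-injective : ∀ {n n′} → n < k → n′ < k → rank n ≡ rank n′ → n ≡ n′
    rank-injective {n} {n′} n<k n′<k eq = by-cases (ℕ.m≤n⇒m<n∨m≡n n<k) (ℕ.m≤n⇒m<n∨m≡n n′<k)
      where
      by-cases : suc n < k ⊎ suc n ≡ k → suc n′ < k ⊎ suc n′ ≡ k → n ≡ n′
      by-cases (inj₁ inner) (inj₁ inner′) =
        inner-rank-injective (trans (sym (rank-inner inner)) (trans eq (rank-inner inner′)))
      by-cases (inj₁ inner) (inj₂ last′)  =
        contradiction (trans (sym (rank-inner inner)) (trans eq (rank-last last′))) (inner-rank≢last n)
      by-cases (inj₂ last)  (inj₁ inner′) =
        contradiction (trans (sym (rank-inner inner′)) (trans (sym eq) (rank-last last))) (inner-rank≢last n′)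
      by-cases (inj₂ last)  (inj₂ last′)  = ℕ.suc-injective (trans last (sym last′))

  +[1∸c]≡1-c : ∀ {c} → c ≤ 1 → + (1 ∸ c) ≡ + 1 - + c
  +[1∸c]≡1-c z≤n       = refl
  +[1∸c]≡1-c (s≤s z≤n) = refl

  closing-edge-length : ∀ s c r (c≤1 : c ≤ 1) → r ≤ 1 → let open ZigzagCycle s c r c≤1 in
    ∀ {n} → suc n ≡ k → + vertex 0 - + vertex n ≡ - (+ k - + suc (s ℕ.+ s))
  closing-edge-length s c 0 c≤1 z≤n {n} last = begin
    + vertex 0 - + vertex n            ≡⟨ cong₂ (λ x y → x - + y) (+[1∸c]≡1-c c≤1) vertex-n ⟩
    (+ 1 - + c) - (+ 2 + + A + + 1)    ≡⟨ close (+ s) (+ c) ⟩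
    - (+ k - + suc (s ℕ.+ s))          ∎
    where
    open ZigzagCycle s c 0 c≤1
    open ≡-Reasoning
    A = s ℕ.+ s ℕ.+ c
    last-position : ∀ s c → 2 ℕ.+ (s ℕ.+ s) ℕ.+ (s ℕ.+ s) ℕ.+ (c ℕ.+ c) ℕ.+ 0
                            ≡ suc (suc ((s ℕ.+ s ℕ.+ c) ℕ.+ (s ℕ.+ s ℕ.+ c)))
    last-position = ℕ-solver.solve-∀
    vertex-n : vertex n ≡ 2 ℕ.+ A ℕ.+ 1
    vertex-n = trans (cong vertex (trans (ℕ.suc-injective last) (last-position s c)))
      (trans (vertex-low A) (cong (2 ℕ.+ A ℕ.+_) (skip-≥ (ℕ.≤-trans (ℕ.m≤m+n s s) (ℕ.m≤m+n (s ℕ.+ s) c)))))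
    close : ∀ s c → (+ 1 - c) - (+ 2 + (s + s + c) + + 1)
                    ≡ - ((+ 3 + (s + s) + (s + s) + (c + c) + + 0) - (+ 1 + (s + s)))
    close = solve-∀
  closing-edge-length s c 1 c≤1 (s≤s z≤n) {n} last = begin
    + vertex 0 - + vertex n            ≡⟨ cong₂ (λ x y → x - + y) (+[1∸c]≡1-c c≤1) vertex-n ⟩
    (+ 1 - + c) - + hi A               ≡⟨ cong (_-_ (+ 1 - + c)) (hi≡ (a≤suc-k {A} A-position<k)) ⟩
    (+ 1 - + c) - (+ suc k - + A)      ≡⟨ close (+ s) (+ c) ⟩
    - (+ k - + suc (s ℕ.+ s))          ∎
    where
    open ZigzagCycle s c 1 c≤1
    open ≡-Reasoning
    A = s ℕ.+ s ℕ.+ c ℕ.+ 1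
    last-position : ∀ s c → 2 ℕ.+ (s ℕ.+ s) ℕ.+ (s ℕ.+ s) ℕ.+ (c ℕ.+ c) ℕ.+ 1
                            ≡ suc ((s ℕ.+ s ℕ.+ c ℕ.+ 1) ℕ.+ (s ℕ.+ s ℕ.+ c ℕ.+ 1))
    last-position = ℕ-solver.solve-∀
    n≡ : n ≡ suc (A ℕ.+ A)
    n≡ = trans (ℕ.suc-injective last) (last-position s c)
    A-position<k : suc (A ℕ.+ A) < k
    A-position<k = subst (_< k) n≡ (subst (n <_) last (ℕ.n<1+n n))
    vertex-n : vertex n ≡ hi A
    vertex-n = trans (cong vertex n≡) (vertex-high A)
    close : ∀ s c → (+ 1 - c) - ((+ 1 + (+ 3 + (s + s) + (s + s) + (c + c) + + 1)) - (s + s + c + + 1))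
                    ≡ - ((+ 3 + (s + s) + (s + s) + (c + c) + + 1) - (+ 1 + (s + s)))
    close = solve-∀

  zigzag-isBaseCycle : ∀ s c r (c≤1 : c ≤ 1) → r ≤ 1 → let open ZigzagCycle s c r c≤1 in
    ∃ λ v → IsBaseCycle (2 ℕ.* k ℕ.+ 1) k v
  zigzag-isBaseCycle s c r c≤1 r≤1 =
    v , distinct-lengths⇒isBaseCycle edge-rank vertices-distinct edge-rank-injective edge-length
    where
    open ZigzagCycle s c r c≤1
    v : Fin k → ℤ
    v j = + vertex (toℕ j)
    edge-rank : Fin k → Fin k
    edge-rank j = fromℕ< (rank<k (Fin.toℕ<n j))
    toℕ-edge-rank : ∀ j → toℕ (edge-rank j) ≡ rank (toℕ j)
    toℕ-edge-rank j = Fin.toℕ-fromℕ< (rank<k (Fin.toℕ<n j))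
    vertices-distinct : ∀ {j j′} → v j ≡ v j′ mod (2 ℕ.* k ℕ.+ 1) → j ≡ j′
    vertices-distinct {j} {j′} h = Fin.toℕ-injective (vertex-injective (Fin.toℕ<n j) (Fin.toℕ<n j′)
      (mod-unique (vertex<m (Fin.toℕ<n j)) (vertex<m (Fin.toℕ<n j′)) h))
    edge-rank-injective : ∀ {j j′} → edge-rank j ≡ edge-rank j′ → j ≡ j′
    edge-rank-injective {j} {j′} eq = Fin.toℕ-injective (rank-injective (Fin.toℕ<n j) (Fin.toℕ<n j′)
      (trans (sym (toℕ-edge-rank j)) (trans (cong toℕ eq) (toℕ-edge-rank j′))))
    EdgeLength : Fin k → Set
    EdgeLength j = ∃ λ o → Δ v j ≡ signed o (+ k - toℤ (edge-rank j)) mod (2 ℕ.* k ℕ.+ 1)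
    edge-length : ∀ j → EdgeLength j
    edge-length j = [ inner-edge , closing-edge ]′ (toℕ-nextIx j)
      where
      n = toℕ j
      Δv≡ : ∀ {n′} → toℕ (nextIx j) ≡ n′ → Δ v j ≡ + vertex n′ - + vertex n
      Δv≡ = cong (λ n′ → + vertex n′ - + vertex n)
      inner-edge : suc n < k × toℕ (nextIx j) ≡ suc n → EdgeLength j
      inner-edge (inner , next≡) =
        let o , Δ≡ = inner-edge-length n inner
        in o , mod-trans (mod-reflexive (Δv≡ next≡)) (mod-trans Δ≡ (mod-reflexive
                 (cong (λ x → signed o (+ k - + x)) (sym (trans (toℕ-edge-rank j) (rank-inner inner))))))
      closing-edge : suc n ≡ k × toℕ (nextIx j) ≡ 0 → EdgeLength j
      closing-edge (last , next≡) = backward , mod-reflexive (begin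
        Δ v j                          ≡⟨ Δv≡ next≡ ⟩
        + vertex 0 - + vertex n        ≡⟨ closing-edge-length s c r c≤1 r≤1 last ⟩
        - (+ k - + suc (s ℕ.+ s))      ≡⟨ cong (λ x → - (+ k - + x)) (trans (toℕ-edge-rank j) (rank-last last)) ⟨
        - (+ k - toℤ (edge-rank j))    ∎)
        where open ≡-Reasoning

  zigzag-shape : ∀ n → ∃₂ λ s c → ∃ λ r → c ≤ 1 × r ≤ 1 × n ≡ (s ℕ.+ s) ℕ.+ (s ℕ.+ s) ℕ.+ (c ℕ.+ c) ℕ.+ r
  zigzag-shape zero = 0 , 0 , 0 , z≤n , z≤n , refl
  zigzag-shape (suc n) with zigzag-shape n
  ... | s , c , 0 , c≤1     , _       , n≡ = s , c , 1 , c≤1 , s≤s z≤n , trans (cong suc n≡) (step s c)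
    where
    step : ∀ s c → suc ((s ℕ.+ s) ℕ.+ (s ℕ.+ s) ℕ.+ (c ℕ.+ c) ℕ.+ 0)
                   ≡ (s ℕ.+ s) ℕ.+ (s ℕ.+ s) ℕ.+ (c ℕ.+ c) ℕ.+ 1
    step = ℕ-solver.solve-∀
  ... | s , 0 , 1 , z≤n     , s≤s z≤n , n≡ = s , 1 , 0 , s≤s z≤n , z≤n , trans (cong suc n≡) (step s)
    where
    step : ∀ s → suc ((s ℕ.+ s) ℕ.+ (s ℕ.+ s) ℕ.+ 0 ℕ.+ 1) ≡ (s ℕ.+ s) ℕ.+ (s ℕ.+ s) ℕ.+ 2 ℕ.+ 0
    step = ℕ-solver.solve-∀
  ... | s , 1 , 1 , s≤s z≤n , s≤s z≤n , n≡ = suc s , 0 , 0 , z≤n , z≤n , trans (cong suc n≡) (step s)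
    where
    step : ∀ s → suc ((s ℕ.+ s) ℕ.+ (s ℕ.+ s) ℕ.+ 2 ℕ.+ 1)
                 ≡ (suc s ℕ.+ suc s) ℕ.+ (suc s ℕ.+ suc s) ℕ.+ 0 ℕ.+ 0
    step = ℕ-solver.solve-∀

  base-cycle-exists : ∀ k → 3 ≤ k → ∃ λ v → IsBaseCycle (2 ℕ.* k ℕ.+ 1) k v
  base-cycle-exists (suc (suc (suc n))) (s≤s (s≤s (s≤s _))) =
    let s , c , r , c≤1 , r≤1 , n≡ = zigzag-shape n
    in subst (λ n → ∃ λ v → IsBaseCycle (2 ℕ.* (3 ℕ.+ n) ℕ.+ 1) (3 ℕ.+ n) v) (sym n≡)
             (zigzag-isBaseCycle s c r c≤1 r≤1)

module StandardLifting where

  open import Data.Integer using (_+_; _*_; -_; _-_)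
  open Congruence
  open CycleEdges
  open Lifting

  proportional-slopes⇒isOrthogonalLifting : ∀ {p k} {A B : Fin k → ℤ} → Prime p → k ≤ p →
    (∀ j → ¬ (+ p ∣ Δ A j)) → (∀ j → Δ B j ≡ Δ A j * toℤ j) → IsOrthogonalLifting p k A B
  proportional-slopes⇒isOrthogonalLifting {p} {k} {A} {B} p-prime k≤p slope-nonzero proportional =
    record { slope-nonzero = slope-nonzero ; slopes-independent = slopes-independent }
    where
    slopes-independent : ∀ {j l} → j ≢ l → ¬ (+ p ∣ Δ A j * Δ B l - Δ A l * Δ B j)
    slopes-independent {j} {l} j≢l p∣det =
      [ [ slope-nonzero j , slope-nonzero l ]′ ∘′ prime-∣-* p-prime , positions-distinct ]′
      (prime-∣-* p-prime (subst (+ p ∣_) det≡ p∣det))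
      where
      det≡ : Δ A j * Δ B l - Δ A l * Δ B j ≡ (Δ A j * Δ A l) * (toℤ l - toℤ j)
      det≡ = trans (cong₂ (λ b b′ → Δ A j * b - Δ A l * b′) (proportional l) (proportional j))
                   (factor (Δ A j) (Δ A l) (toℤ j) (toℤ l))
        where
        factor : ∀ a a′ j l → a * (a′ * l) - a′ * (a * j) ≡ (a * a′) * (l - j)
        factor = solve-∀
      positions-distinct : ¬ (+ p ∣ toℤ l - toℤ j)
      positions-distinct p∣l-j = j≢l (sym (Fin.toℕ-injective
        (mod-unique (ℕ.<-≤-trans (Fin.toℕ<n l) k≤p) (ℕ.<-≤-trans (Fin.toℕ<n j) k≤p) (congruent p∣l-j))))

  module _ (k : ℕ) where

    linear quadratic : ℕ → ℤ
    linear zero    = + 0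
    linear (suc n) = + (suc n ℕ.+ suc n) - + k
    quadratic n    = + n * (+ n - + 1)

    A B : Fin k → ℤ
    A = linear ∘ toℕ
    B = quadratic ∘ toℕ

    ProportionalStep : ℕ → ℕ → Set
    ProportionalStep n n′ = let α = linear n′ - linear n in
      (α ≡ + 2 ⊎ α ≡ + 2 - + k) × quadratic n′ - quadratic n ≡ α * + n

    proportional-step : 3 ≤ k → ∀ n {n′} → (suc n < k × n′ ≡ suc n) ⊎ (suc n ≡ k × n′ ≡ 0) →
                        ProportionalStep n n′
    proportional-step _ zero (inj₁ (_ , refl)) = inj₂ (start (+ k)) , sym (ℤ.*-zeroʳ (linear 1 - linear 0))
      where
      start : ∀ k → (+ 2 - k) - + 0 ≡ + 2 - k
      start = solve-∀
    proportional-step _ (suc n) (inj₁ (_ , refl)) =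
      inj₁ (step (+ n) (+ k)) , trans (quadratic-step (+ n)) (cong (_* + suc n) (sym (step (+ n) (+ k))))
      where
      step : ∀ n k → (+ 2 + n + (+ 2 + n) - k) - (+ 1 + n + (+ 1 + n) - k) ≡ + 2
      step = solve-∀
      quadratic-step : ∀ n → (+ 2 + n) * ((+ 2 + n) - + 1) - (+ 1 + n) * ((+ 1 + n) - + 1) ≡ + 2 * (+ 1 + n)
      quadratic-step = solve-∀
    proportional-step (s≤s (s≤s (s≤s _))) zero (inj₂ (() , _))
    proportional-step _ (suc n) (inj₂ (last , refl)) =
      inj₂ (trans α≡ (cong (λ k → + 2 - + k) last)) , trans (quadratic-closing (+ n)) (cong (_* + suc n) (sym α≡))
      where
      closing : ∀ n → + 0 - (+ 1 + n + (+ 1 + n) - (+ 2 + n)) ≡ + 2 - (+ 2 + n)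
      closing = solve-∀
      quadratic-closing : ∀ n → + 0 * (+ 0 - + 1) - (+ 1 + n) * ((+ 1 + n) - + 1) ≡ (+ 2 - (+ 2 + n)) * (+ 1 + n)
      quadratic-closing = solve-∀
      α≡ : linear 0 - linear (suc n) ≡ + 2 - + suc (suc n)
      α≡ = trans (cong (λ k → + 0 - (+ (suc n ℕ.+ suc n) - + k)) (sym last)) (closing (+ n))

    isOrthogonalLifting : ∀ {p} → Prime p → 3 ≤ p → 3 ≤ k → k ≤ p → IsOrthogonalLifting p k A B
    isOrthogonalLifting {p} p-prime 3≤p 3≤k k≤p = proportional-slopes⇒isOrthogonalLifting p-prime k≤p
      (λ j → nonzero (proj₁ (step j))) (λ j → proj₂ (step j))
      where
      step : ∀ j → ProportionalStep (toℕ j) (toℕ (nextIx j))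
      step j = proportional-step 3≤k (toℕ j) (toℕ-nextIx j)
      2≤k : 2 ≤ k
      2≤k = ℕ.<⇒≤ 3≤k
      nonzero : ∀ {α} → α ≡ + 2 ⊎ α ≡ + 2 - + k → ¬ (+ p ∣ α)
      nonzero (inj₁ refl) = small-∤ ℕ.z<s 3≤p
      nonzero (inj₂ refl) p∣α = small-∤ (ℕ.m<n⇒0<n∸m 3≤k) (ℕ.<-≤-trans (ℕ.∸-monoʳ-< ℕ.z<s 2≤k) k≤p)
        (subst (+ p ∣_) (trans (negate (+ k)) (trans (ℤ.m-n≡m⊖n k 2) (ℤ.⊖-≥ 2≤k))) (∣m⇒∣-m p∣α))
        where
        negate : ∀ k → - (+ 2 - k) ≡ k - + 2
        negate = solve-∀

open import Data.Nat using (_+_; _*_)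
open import Data.Product using (Σ)

theorem5p4 : (p k : ℕ) → Prime p → 3 ≤ p → 3 ≤ k → k ≤ p →
    Σ (Fin p → List (Cyc k ((2 * k + 1) * p))) λ F →
      (∀ i → IsCyclicKCycleDecomp (2 * k + 1) p k (F i)) ×
      (∀ i j → i ≢ j → Orthogonal (F i) (F j))
theorem5p4 p k p-prime 3≤p 3≤k k≤p = family , family-isCyclicDecomposition , families-orthogonal
  where
  instance
    2k+1≢0 : NonZero (2 * k + 1)
    2k+1≢0 = ℕ.>-nonZero (ℕ.m≤n+m 1 (2 * k))
  open Lifting.LiftedDecompositions (2 * k + 1) p k p-prime
    (proj₂ (BaseCycle.base-cycle-exists k 3≤k))
    (StandardLifting.isOrthogonalLifting k p-prime 3≤p 3≤k k≤p)
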